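{- In $\mathsf{PG}(2,8)$, let $\mathcal{K}$ be the conic $X^2+YZ=0$ and let $\mathcal{F}$ be the set of the five points $A=(1,1,0)$, $C_1=(0,1,1)$, $C_2=(\gamma,\gamma^6,1)$, $C_3=(\gamma^2,\gamma^5,1)$, $C_4=(\gamma^4,\gamma^3,1)$. Then $\mathcal{F}$ is an external pentagon with respect to $\mathcal{K}$, and it is of type $A_4$, with the group $G_0=\langle\Gamma,\Phi\rangle\cong A_4$ preserving $\mathcal{K}$ and $\mathcal{F}$.
   Context: $\gamma\in\mathbb{F}_8$ is a fixed root of $X^3+X+1$. $\operatorname{tr}(x)=x+x^2+x^4$ is the trace of $\mathbb{F}_8$ over $\mathbb{F}_2$. $\Phi$ is the collineation $(x,y,z)\mapsto(x^2,y^2,z^2)$ of $\mathsf{PG}(2,8)$; for $c\in\mathbb{F}_8$, $\tau_c$ is the collineation $(x,y,z)\mapsto(x+cz,\,y+c^2z,\,z)$; $\Gamma=\{\tau_c\mid \operatorname{tr}(c)=0\}$. A line is external to $\mathcal{K}$ if it misses $\mathcal{K}$. Five points in general position form an external pentagon with respect to $\mathcal{K}$ if all lines joining two of them are external to $\mathcal{K}$; it is of type $A_4$ if some group of collineations isomorphic to $A_4$ preserves both $\mathcal{K}$ and the five-point set. -}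

module Defs where

open import Data.Bool using (Bool; true; false; _xor_; _∧_; if_then_else_)
open import Data.Nat using (ℕ; zero; suc)
import Data.Nat as ℕ
open import Data.Nat.Divisibility using (_∣_)
open import Data.Fin using (Fin)
import Data.Fin as Fin
open import Data.List using (List; map)
open import Data.Nat.ListAction using (sum)
open import Data.List using () renaming (allFin to allFinL)
open import Data.Product using (Σ; ∃; _×_; _,_)
open import Relation.Nullary using (¬_)
open import Relation.Nullary.Decidable using (⌊_⌋)
open import Relation.Binary.PropositionalEquality using (_≡_)
open import Function using (_∘_; Injective)

-- The field F_8 = F_2[X]/(X^3+X+1); an element f8 a b c stands for
-- a + b·γ + c·γ², where γ is the class of X (a root of X^3+X+1).

record F8 : Set where
  constructor f8
  field
    c0 c1 c2 : Bool

0F 1F γ : F8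
0F = f8 false false false
1F = f8 true false false
γ  = f8 false true false

infixl 6 _+F_
infixl 7 _*F_

_+F_ : F8 → F8 → F8
f8 a0 a1 a2 +F f8 b0 b1 b2 = f8 (a0 xor b0) (a1 xor b1) (a2 xor b2)

-- product, reduced with γ³ = γ + 1 and γ⁴ = γ² + γ
_*F_ : F8 → F8 → F8
f8 a0 a1 a2 *F f8 b0 b1 b2 =
  let p0 = a0 ∧ b0
      p1 = (a0 ∧ b1) xor (a1 ∧ b0)
      p2 = ((a0 ∧ b2) xor (a1 ∧ b1)) xor (a2 ∧ b0)
      p3 = (a1 ∧ b2) xor (a2 ∧ b1)
      p4 = a2 ∧ b2
  in f8 (p0 xor p3) ((p1 xor p3) xor p4) (p2 xor p4)

_^F_ : F8 → ℕ → F8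
x ^F zero  = 1F
x ^F suc n = x *F (x ^F n)

tr : F8 → F8
tr x = x +F (x ^F 2) +F (x ^F 4)

-- PG(2,8): points are nonzero vectors of F_8^3 up to nonzero scalars.

V : Set
V = F8 × F8 × F8

zeroV : V
zeroV = 0F , 0F , 0F

NonZeroV : V → Set
NonZeroV v = ¬ v ≡ zeroV

_~_ : V → V → Set
(x , y , z) ~ w = ∃ λ l → ¬ l ≡ 0F × w ≡ (l *F x , l *F y , l *F z)

-- lines: nonzero coefficient vectors (a,b,c), the line aX+bY+cZ=0
OnLine : V → V → Set
OnLine (a , b , c) (x , y , z) = a *F x +F b *F y +F c *F z ≡ 0F

Collinear : V → V → V → Set
Collinear P Q R = ∃ λ L → NonZeroV L × OnLine L P × OnLine L Q × OnLine L R

OnK : V → Set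
OnK (x , y , z) = x *F x +F y *F z ≡ 0F

ExternalLine : V → Set
ExternalLine L = ∀ P → NonZeroV P → OnLine L P → ¬ OnK P

GeneralPosition : (Fin 5 → V) → Set
GeneralPosition F =
  (∀ i → NonZeroV (F i)) ×
  (∀ i j k → ¬ i ≡ j → ¬ j ≡ k → ¬ i ≡ k → ¬ Collinear (F i) (F j) (F k))

ExternalPentagon : (Fin 5 → V) → Set
ExternalPentagon F =
  GeneralPosition F ×
  (∀ i j → ¬ i ≡ j → ∀ L → NonZeroV L → OnLine L (F i) → OnLine L (F j) →
     ExternalLine L)

Φ : V → V
Φ (x , y , z) = x ^F 2 , y ^F 2 , z ^F 2

-- inverse of Φ (x ↦ x⁴, since x⁸ = x in F_8)
Φinv : V → V
Φinv (x , y , z) = x ^F 4 , y ^F 4 , z ^F 4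

τ : F8 → V → V
τ c (x , y , z) = x +F c *F z , y +F (c ^F 2) *F z , z

-- τ_c is an involution (characteristic 2), so Γ is closed under inverses.
-- InG0 g : g is a word in the generators Φ, Φ⁻¹, τ_c (tr c = 0).
data InG0 : (V → V) → Set where
  g-id   : InG0 (λ v → v)
  g-Φ    : ∀ {g} → InG0 g → InG0 (Φ ∘ g)
  g-Φinv : ∀ {g} → InG0 g → InG0 (Φinv ∘ g)
  g-τ    : ∀ {g} c → tr c ≡ 0F → InG0 g → InG0 (τ c ∘ g)

_≈C_ : (V → V) → (V → V) → Set
g ≈C h = ∀ v → NonZeroV v → g v ~ h v

inversions : (Fin 4 → Fin 4) → ℕ
inversions σ =
  sum (map (λ i → sum (map (λ j →
         if ⌊ i Fin.<? j ⌋ ∧ ⌊ σ j Fin.<? σ i ⌋ then 1 else 0)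
       (allFinL 4))) (allFinL 4))

IsA4 : (Fin 4 → Fin 4) → Set
IsA4 σ = Injective _≡_ _≡_ σ × (2 ∣ inversions σ)

_≗4_ : (Fin 4 → Fin 4) → (Fin 4 → Fin 4) → Set
σ ≗4 ρ = ∀ i → σ i ≡ ρ i

IsoA4G0 : ((Fin 4 → Fin 4) → (V → V)) → Set
IsoA4G0 f =
  (∀ σ → IsA4 σ → InG0 (f σ)) ×
  (∀ σ ρ → IsA4 σ → IsA4 ρ → σ ≗4 ρ → f σ ≈C f ρ) ×
  (∀ σ ρ → IsA4 σ → IsA4 ρ → f σ ≈C f ρ → σ ≗4 ρ) ×
  (∀ g → InG0 g → ∃ λ σ → IsA4 σ × f σ ≈C g) ×
  (∀ σ ρ → IsA4 σ → IsA4 ρ → f (σ ∘ ρ) ≈C (f σ ∘ f ρ))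

𝓕 : Fin 5 → V
𝓕 Fin.zero = 1F , 1F , 0F
𝓕 (Fin.suc Fin.zero) = 0F , 1F , 1F
𝓕 (Fin.suc (Fin.suc Fin.zero)) = γ , γ ^F 6 , 1F
𝓕 (Fin.suc (Fin.suc (Fin.suc Fin.zero))) = γ ^F 2 , γ ^F 5 , 1F
𝓕 (Fin.suc (Fin.suc (Fin.suc (Fin.suc Fin.zero)))) = γ ^F 4 , γ ^F 3 , 1F

PreservesK : (V → V) → Set
PreservesK g = ∀ v → NonZeroV v → (OnK v → OnK (g v)) × (OnK (g v) → OnK v)

Preserves𝓕 : (V → V) → Set
Preserves𝓕 g = ∀ i → ∃ λ j → g (𝓕 i) ~ 𝓕 j

module Submission where

open import Defs
open import Data.Bool using (Bool; true; false; if_then_else_)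
import Data.Bool.Properties as Bool
open import Data.Fin using (Fin; zero; suc)
import Data.Fin.Properties as Fin
open import Data.Nat as ℕ using (ℕ; _+_)
open import Data.Nat.Divisibility using (_∣_; _∣?_)
open import Data.Product using (∃; _×_; _,_; proj₁; proj₂)
open import Data.Sum using (inj₁; inj₂)
open import Data.Vec using (_∷_; []; lookup)
open import Data.Vec.Properties using (lookup∘tabulate; tabulate-cong)
open import Function using (_∘_; Injective)
open import Relation.Binary.Core using (_Preserves_⟶_)
open import Relation.Binary.Definitions using (DecidableEquality)
open import Relation.Binary.PropositionalEquality
  using (_≡_; refl; sym; trans; cong; cong₂; subst; subst₂; _≗_; module ≡-Reasoning)
open import Relation.Nullary using (Dec; does; ¬_; ¬?)
open import Relation.Nullary.Decidable using (map′; _×-dec_; _⊎-dec_; _→-dec_; toWitness)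
open import Relation.Unary using (Decidable)

-- Every incidence statement is finite and is decided by evaluation over F₈ and
-- PG(2,8). The group is handled by its action on the conic points P(t) = (t, t², 1):
-- τ_c Φ^k sends P(t) to P(c + t^(2^k)). On the four points P(t) with tr t = 0, i.e. with
-- t in T = {0, γ, γ², γ⁴} ≅ F₂², this is the affine group V₄ ⋊ C₃ ≅ A₄, and a map
-- τ_c Φ^k is determined by the images of P(0) and P(γ), since Φ has order 3. So the
-- A₄-element σ corresponds to the τ_c Φ^k acting on these four points as σ does.

∀-Bool? : {P : Bool → Set} → Decidable P → Dec (∀ b → P b)
∀-Bool? P? = map′ (λ (f , t) → λ { false → f ; true → t }) (λ p → p false , p true)
  (P? false ×-dec P? true)

∃-Bool? : {P : Bool → Set} → Decidable P → Dec (∃ P)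
∃-Bool? P? = map′ (λ { (inj₁ f) → false , f ; (inj₂ t) → true , t })
  (λ { (false , f) → inj₁ f ; (true , t) → inj₂ t }) (P? false ⊎-dec P? true)

∀-F8? : {P : F8 → Set} → Decidable P → Dec (∀ x → P x)
∀-F8? P? = map′ (λ p → λ { (f8 a b c) → p a b c }) (λ p a b c → p (f8 a b c))
  (∀-Bool? λ a → ∀-Bool? λ b → ∀-Bool? λ c → P? (f8 a b c))

∃-F8? : {P : F8 → Set} → Decidable P → Dec (∃ P)
∃-F8? P? = map′ (λ (a , b , c , p) → f8 a b c , p) (λ { (f8 a b c , p) → a , b , c , p })
  (∃-Bool? λ a → ∃-Bool? λ b → ∃-Bool? λ c → P? (f8 a b c))

∀-V? : {P : V → Set} → Decidable P → Dec (∀ v → P v)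
∀-V? P? = map′ (λ p (x , y , z) → p x y z) (λ p x y z → p (x , y , z))
  (∀-F8? λ x → ∀-F8? λ y → ∀-F8? λ z → P? (x , y , z))

∃-V? : {P : V → Set} → Decidable P → Dec (∃ P)
∃-V? P? = map′ (λ (x , y , z , p) → (x , y , z) , p) (λ ((x , y , z) , p) → x , y , z , p)
  (∃-F8? λ x → ∃-F8? λ y → ∃-F8? λ z → P? (x , y , z))

∀-Fun? : {Q : (Fin 4 → Fin 4) → Set} → (∀ {σ ρ} → σ ≗4 ρ → Q σ → Q ρ) →
         (∀ σ → Dec (Q σ)) → Dec (∀ σ → Q σ)
∀-Fun? Q-resp Q? = map′ (λ q σ → Q-resp (lookup∘tabulate σ) (q (σ zero) (σ (suc zero)) _ _))
  (λ q a b c d → q _)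
  (Fin.all? λ a → Fin.all? λ b → Fin.all? λ c → Fin.all? λ d → Q? (lookup (a ∷ b ∷ c ∷ d ∷ [])))

infix 4 _≟F_ _≟V_ _~?_

_≟F_ : DecidableEquality F8
f8 a b c ≟F f8 a′ b′ c′ = map′ (λ { (refl , refl , refl) → refl }) (λ { refl → refl , refl , refl })
  (a Bool.≟ a′ ×-dec b Bool.≟ b′ ×-dec c Bool.≟ c′)

_≟V_ : DecidableEquality V
(x , y , z) ≟V (x′ , y′ , z′) = map′ (λ { (refl , refl , refl) → refl }) (λ { refl → refl , refl , refl })
  (x ≟F x′ ×-dec y ≟F y′ ×-dec z ≟F z′)

_~?_ : ∀ u w → Dec (u ~ w)
(x , y , z) ~? w = ∃-F8? λ l → ¬? (l ≟F 0F) ×-dec w ≟V (l *F x , l *F y , l *F z)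

NonZeroV? : Decidable NonZeroV
NonZeroV? v = ¬? (v ≟V zeroV)

OnLine? : ∀ L P → Dec (OnLine L P)
OnLine? (a , b , c) (x , y , z) = _ ≟F 0F

OnK? : Decidable OnK
OnK? (x , y , z) = _ ≟F 0F

Collinear? : ∀ P Q R → Dec (Collinear P Q R)
Collinear? P Q R = ∃-V? λ L → NonZeroV? L ×-dec OnLine? L P ×-dec OnLine? L Q ×-dec OnLine? L R

ExternalLine? : Decidable ExternalLine
ExternalLine? L = ∀-V? λ P → NonZeroV? P →-dec (OnLine? L P →-dec ¬? (OnK? P))

GeneralPosition? : Decidable GeneralPosition
GeneralPosition? F = Fin.all? (λ i → NonZeroV? (F i)) ×-dec
  (Fin.all? λ i → Fin.all? λ j → Fin.all? λ k →
     ¬? (i Fin.≟ j) →-dec (¬? (j Fin.≟ k) →-dec (¬? (i Fin.≟ k) →-dec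
       ¬? (Collinear? (F i) (F j) (F k)))))

Preserves𝓕? : ∀ h → Dec (Preserves𝓕 h)
Preserves𝓕? h = Fin.all? λ i → Fin.any? λ j → h (𝓕 i) ~? 𝓕 j

conicForm : V → F8
conicForm (x , y , z) = x *F x +F y *F z

frob : ℕ → F8 → F8
frob 0 x = x
frob (ℕ.suc k) x = frob k x ^F 2

-- Facts decided by exhaustive evaluation are kept opaque: unfolding them during conversion
-- checking would re-run the decision procedure.
opaque
  *-identityˡ : ∀ x → 1F *F x ≡ x
  *-identityˡ = toWitness {a? = ∀-F8? λ x → 1F *F x ≟F x} _

  *-identityʳ : ∀ x → x *F 1F ≡ x
  *-identityʳ = toWitness {a? = ∀-F8? λ x → x *F 1F ≟F x} _

  +-identityʳ : ∀ x → x +F 0F ≡ x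
  +-identityʳ = toWitness {a? = ∀-F8? λ x → x +F 0F ≟F x} _

  *-assoc : ∀ x y z → x *F (y *F z) ≡ (x *F y) *F z
  *-assoc = toWitness {a? = ∀-F8? λ x → ∀-F8? λ y → ∀-F8? λ z → x *F (y *F z) ≟F (x *F y) *F z} _

  *-nonzero : ∀ x y → ¬ x ≡ 0F → ¬ y ≡ 0F → ¬ x *F y ≡ 0F
  *-nonzero = toWitness {a? = ∀-F8? λ x → ∀-F8? λ y →
    ¬? (x ≟F 0F) →-dec (¬? (y ≟F 0F) →-dec ¬? (x *F y ≟F 0F))} _

  +-cancelʳ : ∀ x y c → x +F c ≡ y +F c → x ≡ y
  +-cancelʳ = toWitness {a? = ∀-F8? λ x → ∀-F8? λ y → ∀-F8? λ c → (x +F c ≟F y +F c) →-dec (x ≟F y)} _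

  square≡0 : ∀ x → x ^F 2 ≡ 0F → x ≡ 0F
  square≡0 = toWitness {a? = ∀-F8? λ x → (x ^F 2 ≟F 0F) →-dec (x ≟F 0F)} _

  frobenius-* : ∀ x y → (x *F y) ^F 2 ≡ x ^F 2 *F y ^F 2
  frobenius-* = toWitness {a? = ∀-F8? λ x → ∀-F8? λ y → (x *F y) ^F 2 ≟F x ^F 2 *F y ^F 2} _

  frobenius-+ : ∀ x y → (x +F y) ^F 2 ≡ x ^F 2 +F y ^F 2
  frobenius-+ = toWitness {a? = ∀-F8? λ x → ∀-F8? λ y → (x +F y) ^F 2 ≟F x ^F 2 +F y ^F 2} _

  frobenius-affine : ∀ x c z → (x +F c *F z) ^F 2 ≡ x ^F 2 +F c ^F 2 *F z ^F 2
  frobenius-affine = toWitness {a? = ∀-F8? λ x → ∀-F8? λ c → ∀-F8? λ z →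
    (x +F c *F z) ^F 2 ≟F x ^F 2 +F c ^F 2 *F z ^F 2} _

  frob-3 : ∀ x → frob 3 x ≡ x
  frob-3 = toWitness {a? = ∀-F8? λ x → frob 3 x ≟F x} _

  ^4≡frob-2 : ∀ x → x ^F 4 ≡ frob 2 x
  ^4≡frob-2 = toWitness {a? = ∀-F8? λ x → x ^F 4 ≟F frob 2 x} _

  τ-coordinate-+ : ∀ x c d z → (x +F d *F z) +F c *F z ≡ x +F (c +F d) *F z
  τ-coordinate-+ = toWitness {a? = ∀-F8? λ x → ∀-F8? λ c → ∀-F8? λ d → ∀-F8? λ z →
    (x +F d *F z) +F c *F z ≟F x +F (c +F d) *F z} _

  τ-coordinate-* : ∀ l x c z → l *F x +F c *F (l *F z) ≡ l *F (x +F c *F z)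
  τ-coordinate-* = toWitness {a? = ∀-F8? λ l → ∀-F8? λ x → ∀-F8? λ c → ∀-F8? λ z →
    l *F x +F c *F (l *F z) ≟F l *F (x +F c *F z)} _

  conicForm-τ : ∀ c v → conicForm (τ c v) ≡ conicForm v
  conicForm-τ = toWitness {a? = ∀-F8? λ c → ∀-V? λ v → conicForm (τ c v) ≟F conicForm v} _

  conicForm-Φ : ∀ v → conicForm (Φ v) ≡ conicForm v ^F 2
  conicForm-Φ = toWitness {a? = ∀-V? λ v → conicForm (Φ v) ≟F conicForm v ^F 2} _

1≢0 : ¬ 1F ≡ 0F
1≢0 ()

cong-triple : ∀ {x x′ y y′ z z′ : F8} → x ≡ x′ → y ≡ y′ → z ≡ z′ → (x , y , z) ≡ (x′ , y′ , z′)
cong-triple refl refl refl = refl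

infixr 7 _·_

_·_ : F8 → V → V
l · (x , y , z) = l *F x , l *F y , l *F z

·-identityˡ : ∀ v → 1F · v ≡ v
·-identityˡ (x , y , z) = cong-triple (*-identityˡ x) (*-identityˡ y) (*-identityˡ z)

·-assoc : ∀ l m v → l · m · v ≡ (l *F m) · v
·-assoc l m (x , y , z) = cong-triple (*-assoc l m x) (*-assoc l m y) (*-assoc l m z)

~-refl : ∀ v → v ~ v
~-refl v = 1F , 1≢0 , sym (·-identityˡ v)

~-trans : ∀ {u v w} → u ~ v → v ~ w → u ~ w
~-trans {u} (l , l≢0 , refl) (m , m≢0 , refl) = m *F l , *-nonzero m l m≢0 l≢0 , ·-assoc m l u

≗⇒≈C : ∀ {g h} → g ≗ h → g ≈C h
≗⇒≈C g≗h v _ = subst (_ ~_) (g≗h v) (~-refl _)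

semilinear⇒preserves-~ : ∀ {h} (θ : F8 → F8) → (∀ l → ¬ l ≡ 0F → ¬ θ l ≡ 0F) →
  (∀ l v → h (l · v) ≡ θ l · h v) → h Preserves _~_ ⟶ _~_
semilinear⇒preserves-~ θ θ≢0 h-semilinear {u} (l , l≢0 , refl) =
  θ l , θ≢0 l l≢0 , h-semilinear l u

Φ-preserves-~ : Φ Preserves _~_ ⟶ _~_
Φ-preserves-~ = semilinear⇒preserves-~ (_^F 2) (λ l l≢0 → l≢0 ∘ square≡0 l)
  λ l (x , y , z) → cong-triple (frobenius-* l x) (frobenius-* l y) (frobenius-* l z)

τ-preserves-~ : ∀ c → τ c Preserves _~_ ⟶ _~_
τ-preserves-~ c = semilinear⇒preserves-~ (λ l → l) (λ _ l≢0 → l≢0)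
  λ l (x , y , z) → cong-triple (τ-coordinate-* l x c z) (τ-coordinate-* l y (c ^F 2) z) refl

Φinv≗Φ² : Φinv ≗ Φ ∘ Φ
Φinv≗Φ² (x , y , z) = cong-triple (^4≡frob-2 x) (^4≡frob-2 y) (^4≡frob-2 z)

Φinv-preserves-~ : Φinv Preserves _~_ ⟶ _~_
Φinv-preserves-~ {u} {w} u~w =
  subst₂ _~_ (sym (Φinv≗Φ² u)) (sym (Φinv≗Φ² w)) (Φ-preserves-~ (Φ-preserves-~ u~w))

Φ^_ : ℕ → V → V
(Φ^ k) (x , y , z) = frob k x , frob k y , frob k z

Φ^-+ : ∀ k l v → (Φ^ (k + l)) v ≡ (Φ^ k) ((Φ^ l) v)
Φ^-+ 0 l v = refl
Φ^-+ (ℕ.suc k) l v = cong Φ (Φ^-+ k l v)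

τ-τ : ∀ c d v → τ c (τ d v) ≡ τ (c +F d) v
τ-τ c d (x , y , z) = cong-triple (τ-coordinate-+ x c d z)
  (trans (τ-coordinate-+ y (c ^F 2) (d ^F 2) z) (cong (λ e → y +F e *F z) (sym (frobenius-+ c d))))
  refl

τ-zero : ∀ v → τ 0F v ≡ v
τ-zero (x , y , z) = cong-triple (+-identityʳ x) (+-identityʳ y) refl

Φ-τ : ∀ c v → Φ (τ c v) ≡ τ (c ^F 2) (Φ v)
Φ-τ c (x , y , z) = cong-triple (frobenius-affine x c z) (frobenius-affine y (c ^F 2) z) refl

Φ^-τ : ∀ k c v → (Φ^ k) (τ c v) ≡ τ (frob k c) ((Φ^ k) v)
Φ^-τ 0 c v = refl
Φ^-τ (ℕ.suc k) c v = trans (cong Φ (Φ^-τ k c v)) (Φ-τ (frob k c) ((Φ^ k) v))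

affine : F8 → ℕ → V → V
affine c k = τ c ∘ Φ^ k

affine-∘ : ∀ c k d l → affine c k ∘ affine d l ≗ affine (c +F frob k d) (k + l)
affine-∘ c k d l v = begin
  τ c ((Φ^ k) (τ d ((Φ^ l) v)))              ≡⟨ cong (τ c) (Φ^-τ k d ((Φ^ l) v)) ⟩
  τ c (τ (frob k d) ((Φ^ k) ((Φ^ l) v)))     ≡⟨ τ-τ c (frob k d) ((Φ^ k) ((Φ^ l) v)) ⟩
  τ (c +F frob k d) ((Φ^ k) ((Φ^ l) v))      ≡⟨ cong (τ (c +F frob k d)) (sym (Φ^-+ k l v)) ⟩
  τ (c +F frob k d) ((Φ^ (k + l)) v)         ∎
  where open ≡-Reasoning

frob-0 : ∀ k → frob k 0F ≡ 0F
frob-0 0 = refl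
frob-0 (ℕ.suc k) = cong (_^F 2) (frob-0 k)

frob-1 : ∀ k → frob k 1F ≡ 1F
frob-1 0 = refl
frob-1 (ℕ.suc k) = cong (_^F 2) (frob-1 k)

-- Reduce both exponents mod 3; γ, γ², γ⁴ are distinct, so the remaining exponents agree.
frob-determined : ∀ k l → frob k γ ≡ frob l γ → ∀ x → frob k x ≡ frob l x
frob-determined (ℕ.suc (ℕ.suc (ℕ.suc k))) l e x =
  trans (frob-3 (frob k x)) (frob-determined k l (trans (sym (frob-3 (frob k γ))) e) x)
frob-determined k (ℕ.suc (ℕ.suc (ℕ.suc l))) e x =
  trans (frob-determined k l (trans e (frob-3 (frob l γ))) x) (sym (frob-3 (frob l x)))
frob-determined 0 0 _ _ = refl
frob-determined 1 1 _ _ = refl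
frob-determined 2 2 _ _ = refl
frob-determined 0 1 ()
frob-determined 0 2 ()
frob-determined 1 0 ()
frob-determined 1 2 ()
frob-determined 2 0 ()
frob-determined 2 1 ()

traceZero : Fin 4 → F8
traceZero zero = 0F
traceZero (suc zero) = γ
traceZero (suc (suc zero)) = γ ^F 2
traceZero (suc (suc (suc zero))) = γ ^F 4

tracePoint : Fin 4 → V
tracePoint i = traceZero i , traceZero i ^F 2 , 1F

tracePoint≢0 : ∀ i → NonZeroV (tracePoint i)
tracePoint≢0 i e = 1≢0 (cong (proj₂ ∘ proj₂) e)

affine-origin : ∀ c k → proj₁ (affine c k (tracePoint zero)) ≡ c
affine-origin c k = begin
  frob k 0F +F c *F frob k 1F  ≡⟨ cong₂ (λ a b → a +F c *F b) (frob-0 k) (frob-1 k) ⟩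
  c *F 1F                      ≡⟨ *-identityʳ c ⟩
  c                            ∎
  where open ≡-Reasoning

affine-γ : ∀ c k → proj₁ (affine c k (tracePoint (suc zero))) ≡ frob k γ +F c
affine-γ c k = cong (frob k γ +F_) (trans (cong (c *F_) (frob-1 k)) (*-identityʳ c))

affine-determined : ∀ c d k l →
  affine c k (tracePoint zero) ≡ affine d l (tracePoint zero) →
  affine c k (tracePoint (suc zero)) ≡ affine d l (tracePoint (suc zero)) →
  affine c k ≗ affine d l
affine-determined c d k l e₀ e₁ (x , y , z) =
  cong₂ τ c≡d (cong-triple (frob-determined k l frobγ x) (frob-determined k l frobγ y)
                            (frob-determined k l frobγ z))
  where
  c≡d : c ≡ d
  c≡d = trans (sym (affine-origin c k)) (trans (cong proj₁ e₀) (affine-origin d l))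
  frobγ : frob k γ ≡ frob l γ
  frobγ = +-cancelʳ _ _ c (trans (sym (affine-γ c k))
            (trans (cong proj₁ e₁) (trans (affine-γ d l) (cong (frob l γ +F_) (sym c≡d)))))

Injective? : (σ : Fin 4 → Fin 4) → Dec (Injective _≡_ _≡_ σ)
Injective? σ = map′ (λ inj {x} {y} → inj x y) (λ inj x y → inj {x} {y})
  (Fin.all? λ x → Fin.all? λ y → σ x Fin.≟ σ y →-dec x Fin.≟ y)

IsA4? : ∀ σ → Dec (IsA4 σ)
IsA4? σ = Injective? σ ×-dec 2 ∣? inversions σ

inversions-cong : ∀ {σ ρ} → σ ≗4 ρ → inversions σ ≡ inversions ρ
inversions-cong eq = cong (λ v → inversions (lookup v)) (tabulate-cong eq)

IsA4-cong : ∀ {σ ρ} → σ ≗4 ρ → IsA4 σ → IsA4 ρ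
IsA4-cong eq (inj , even) =
  (λ {x} {y} e → inj (trans (eq x) (trans e (sym (eq y))))) , subst (2 ∣_) (inversions-cong eq) even

-- The k with t = γ^(2^k) when t is one of γ, γ², γ⁴ (the value at other t is junk).
frobeniusLog : F8 → ℕ
frobeniusLog t =
  if does (t ≟F γ ^F 2) then 1 else if does (t ≟F γ ^F 4) then 2 else 0

-- τ_c Φ^k with c = traceZero a and c + γ^(2^k) = traceZero b, so that it maps the points
-- over 0 and γ to those over traceZero a and traceZero b.
G : Fin 4 → Fin 4 → V → V
G a b = affine (traceZero a) (frobeniusLog (traceZero a +F traceZero b))

toG₀ : (Fin 4 → Fin 4) → V → V
toG₀ σ = G (σ zero) (σ (suc zero))

opaque
  G-on-tracePoints : ∀ a b → ¬ a ≡ b →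
    G a b (tracePoint zero) ≡ tracePoint a × G a b (tracePoint (suc zero)) ≡ tracePoint b
  G-on-tracePoints = toWitness {a? = Fin.all? λ a → Fin.all? λ b → ¬? (a Fin.≟ b) →-dec
    (G a b (tracePoint zero) ≟V tracePoint a ×-dec G a b (tracePoint (suc zero)) ≟V tracePoint b)} _

  toG₀-on-tracePoints : ∀ σ → IsA4 σ → ∀ i → toG₀ σ (tracePoint i) ≡ tracePoint (σ i)
  toG₀-on-tracePoints = toWitness {a? = ∀-Fun? respects λ σ → IsA4? σ →-dec
    Fin.all? λ i → toG₀ σ (tracePoint i) ≟V tracePoint (σ i)} _
    where
    respects : ∀ {σ ρ} → σ ≗4 ρ →
      (IsA4 σ → ∀ i → toG₀ σ (tracePoint i) ≡ tracePoint (σ i)) →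
      IsA4 ρ → ∀ i → toG₀ ρ (tracePoint i) ≡ tracePoint (ρ i)
    respects eq q ρ∈A4 i =
      trans (cong₂ (λ a b → G a b (tracePoint i)) (sym (eq zero)) (sym (eq (suc zero))))
        (trans (q (IsA4-cong (sym ∘ eq) ρ∈A4) i) (cong tracePoint (eq i)))

  A4-completion : ∀ a b → ¬ a ≡ b → ∃ λ c → ∃ λ d → IsA4 (lookup (a ∷ b ∷ c ∷ d ∷ []))
  A4-completion = toWitness {a? = Fin.all? λ a → Fin.all? λ b → ¬? (a Fin.≟ b) →-dec
    Fin.any? λ c → Fin.any? λ d → IsA4? (lookup (a ∷ b ∷ c ∷ d ∷ []))} _

  tracePoint-injective : ∀ i j → tracePoint i ~ tracePoint j → i ≡ j
  tracePoint-injective = toWitness {a? = Fin.all? λ i → Fin.all? λ j →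
    (tracePoint i ~? tracePoint j) →-dec (i Fin.≟ j)} _

  traceZero-trace : ∀ a → tr (traceZero a) ≡ 0F
  traceZero-trace = toWitness {a? = Fin.all? λ a → tr (traceZero a) ≟F 0F} _

  traceZero-onto : ∀ c → tr c ≡ 0F → ∃ λ a → traceZero a ≡ c
  traceZero-onto = toWitness {a? = ∀-F8? λ c → (tr c ≟F 0F) →-dec Fin.any? λ a → traceZero a ≟F c} _

  translation-partner : ∀ a → ∃ λ b → ¬ a ≡ b × frobeniusLog (traceZero a +F traceZero b) ≡ 0
  translation-partner = toWitness {a? = Fin.all? λ a → Fin.any? λ b →
    ¬? (a Fin.≟ b) ×-dec frobeniusLog (traceZero a +F traceZero b) ℕ.≟ 0} _

toG₀-realises-G : ∀ a b → ¬ a ≡ b → ∃ λ σ → IsA4 σ × toG₀ σ ≗ G a b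
toG₀-realises-G a b a≢b with A4-completion a b a≢b
... | c , d , σ∈A4 = lookup (a ∷ b ∷ c ∷ d ∷ []) , σ∈A4 , λ _ → refl

G-homo : ∀ σ → IsA4 σ → ∀ a b → ¬ a ≡ b → G (σ a) (σ b) ≗ toG₀ σ ∘ G a b
G-homo σ σ∈A4 a b a≢b v =
  trans (affine-determined (traceZero (σ a)) (c +F frob k d)
           (frobeniusLog (traceZero (σ a) +F traceZero (σ b))) (k + l)
           (agree zero a (proj₁ Gσ) (proj₁ Gab))
           (agree (suc zero) b (proj₂ Gσ) (proj₂ Gab)) v)
        (sym (affine-∘ c k d l v))
  where
  open ≡-Reasoning
  c d : F8
  c = traceZero (σ zero)
  d = traceZero a
  k l : ℕ
  k = frobeniusLog (c +F traceZero (σ (suc zero)))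
  l = frobeniusLog (d +F traceZero b)
  Gσ : G (σ a) (σ b) (tracePoint zero) ≡ tracePoint (σ a) ×
       G (σ a) (σ b) (tracePoint (suc zero)) ≡ tracePoint (σ b)
  Gσ = G-on-tracePoints (σ a) (σ b) (a≢b ∘ proj₁ σ∈A4)
  Gab : G a b (tracePoint zero) ≡ tracePoint a × G a b (tracePoint (suc zero)) ≡ tracePoint b
  Gab = G-on-tracePoints a b a≢b
  agree : ∀ i j → G (σ a) (σ b) (tracePoint i) ≡ tracePoint (σ j) →
          G a b (tracePoint i) ≡ tracePoint j →
          G (σ a) (σ b) (tracePoint i) ≡ affine (c +F frob k d) (k + l) (tracePoint i)
  agree i j e₁ e₂ = begin
    G (σ a) (σ b) (tracePoint i)                   ≡⟨ e₁ ⟩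
    tracePoint (σ j)                               ≡⟨ sym (toG₀-on-tracePoints σ σ∈A4 j) ⟩
    toG₀ σ (tracePoint j)                          ≡⟨ cong (toG₀ σ) (sym e₂) ⟩
    toG₀ σ (G a b (tracePoint i))                  ≡⟨ affine-∘ c k d l (tracePoint i) ⟩
    affine (c +F frob k d) (k + l) (tracePoint i)  ∎

InG-image : (V → V) → Set
InG-image h = ∃ λ a → ∃ λ b → ¬ a ≡ b × G a b ≗ h

id∈G-image : InG-image (λ v → v)
id∈G-image = zero , suc zero , (λ ()) , τ-zero

Φ∈G-image : InG-image Φ
Φ∈G-image = zero , suc (suc zero) , (λ ()) , τ-zero ∘ Φ

Φinv∈G-image : InG-image Φinv
Φinv∈G-image = zero , suc (suc (suc zero)) , (λ ()) , λ v → trans (τ-zero (Φ (Φ v))) (sym (Φinv≗Φ² v))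

τ∈G-image : ∀ c → tr c ≡ 0F → InG-image (τ c)
τ∈G-image c tr≡0 with traceZero-onto c tr≡0
... | a , refl with translation-partner a
...   | b , a≢b , log≡0 = a , b , a≢b , λ v → cong (λ k → τ (traceZero a) ((Φ^ k) v)) log≡0

∘-InG-image : ∀ {h g} → InG-image h → InG-image g → InG-image (h ∘ g)
∘-InG-image {h} {g} (a , b , a≢b , Gab≗h) (a′ , b′ , a′≢b′ , Ga′b′≗g)
  with toG₀-realises-G a b a≢b
... | σ , σ∈A4 , σ≗Gab = σ a′ , σ b′ , a′≢b′ ∘ proj₁ σ∈A4 , λ v → begin
    G (σ a′) (σ b′) v   ≡⟨ G-homo σ σ∈A4 a′ b′ a′≢b′ v ⟩
    toG₀ σ (G a′ b′ v)  ≡⟨ σ≗Gab (G a′ b′ v) ⟩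
    G a b (G a′ b′ v)   ≡⟨ Gab≗h (G a′ b′ v) ⟩
    h (G a′ b′ v)       ≡⟨ cong h (Ga′b′≗g v) ⟩
    h (g v)             ∎
  where open ≡-Reasoning

G₀⊆G-image : ∀ {g} → InG0 g → InG-image g
G₀⊆G-image g-id = id∈G-image
G₀⊆G-image (g-Φ g∈G₀) = ∘-InG-image Φ∈G-image (G₀⊆G-image g∈G₀)
G₀⊆G-image (g-Φinv g∈G₀) = ∘-InG-image Φinv∈G-image (G₀⊆G-image g∈G₀)
G₀⊆G-image (g-τ c tr≡0 g∈G₀) = ∘-InG-image (τ∈G-image c tr≡0) (G₀⊆G-image g∈G₀)

Φ^∈G₀ : ∀ k → InG0 (Φ^ k)
Φ^∈G₀ 0 = g-id
Φ^∈G₀ (ℕ.suc k) = g-Φ (Φ^∈G₀ k)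

toG₀-∈G₀ : ∀ σ → InG0 (toG₀ σ)
toG₀-∈G₀ σ = g-τ (traceZero (σ zero)) (traceZero-trace (σ zero))
  (Φ^∈G₀ (frobeniusLog (traceZero (σ zero) +F traceZero (σ (suc zero)))))

toG₀-cong : ∀ {σ ρ} → σ ≗4 ρ → toG₀ σ ≈C toG₀ ρ
toG₀-cong eq = ≗⇒≈C λ v → cong₂ (λ a b → G a b v) (eq zero) (eq (suc zero))

toG₀-injective : ∀ {σ ρ} → IsA4 σ → IsA4 ρ → toG₀ σ ≈C toG₀ ρ → σ ≗4 ρ
toG₀-injective {σ} {ρ} σ∈A4 ρ∈A4 σ≈ρ i = tracePoint-injective (σ i) (ρ i)
  (subst₂ _~_ (toG₀-on-tracePoints σ σ∈A4 i) (toG₀-on-tracePoints ρ ρ∈A4 i)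
    (σ≈ρ (tracePoint i) (tracePoint≢0 i)))

toG₀-homo : ∀ {σ ρ} → IsA4 σ → IsA4 ρ → toG₀ (σ ∘ ρ) ≈C (toG₀ σ ∘ toG₀ ρ)
toG₀-homo {σ} {ρ} σ∈A4 ρ∈A4 =
  ≗⇒≈C (G-homo σ σ∈A4 (ρ zero) (ρ (suc zero)) (Fin.0≢1+n ∘ proj₁ ρ∈A4))

toG₀-onto : ∀ {g} → InG0 g → ∃ λ σ → IsA4 σ × toG₀ σ ≈C g
toG₀-onto g∈G₀ with G₀⊆G-image g∈G₀
... | a , b , a≢b , Gab≗g with toG₀-realises-G a b a≢b
...   | σ , σ∈A4 , σ≗Gab = σ , σ∈A4 , ≗⇒≈C λ v → trans (σ≗Gab v) (Gab≗g v)

toG₀-isomorphism : IsoA4G0 toG₀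
toG₀-isomorphism =
  (λ σ _ → toG₀-∈G₀ σ) ,
  (λ _ _ _ _ → toG₀-cong) ,
  (λ _ _ → toG₀-injective) ,
  (λ _ → toG₀-onto) ,
  (λ _ _ → toG₀-homo)

KInvariant : (V → V) → Set
KInvariant h = ∀ v → (OnK v → OnK (h v)) × (OnK (h v) → OnK v)

KInvariant-∘ : ∀ {h g} → KInvariant h → KInvariant g → KInvariant (h ∘ g)
KInvariant-∘ {g = g} h-inv g-inv v =
  proj₁ (h-inv (g v)) ∘ proj₁ (g-inv v) , proj₂ (g-inv v) ∘ proj₂ (h-inv (g v))

τ-KInvariant : ∀ c → KInvariant (τ c)
τ-KInvariant c v = trans (conicForm-τ c v) , trans (sym (conicForm-τ c v))

Φ-KInvariant : KInvariant Φ
Φ-KInvariant v = (λ e → trans (conicForm-Φ v) (cong (_^F 2) e)) ,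
                 λ e → square≡0 (conicForm v) (trans (sym (conicForm-Φ v)) e)

Φinv-KInvariant : KInvariant Φinv
Φinv-KInvariant v = subst P (sym (Φinv≗Φ² v)) (KInvariant-∘ {Φ} {Φ} Φ-KInvariant Φ-KInvariant v)
  where
  P : V → Set
  P w = (OnK v → OnK w) × (OnK w → OnK v)

G₀-KInvariant : ∀ {g} → InG0 g → KInvariant g
G₀-KInvariant g-id v = (λ e → e) , (λ e → e)
G₀-KInvariant (g-Φ {g} g∈G₀) = KInvariant-∘ {Φ} {g} Φ-KInvariant (G₀-KInvariant g∈G₀)
G₀-KInvariant (g-Φinv {g} g∈G₀) = KInvariant-∘ {Φinv} {g} Φinv-KInvariant (G₀-KInvariant g∈G₀)
G₀-KInvariant (g-τ {g} c _ g∈G₀) = KInvariant-∘ {τ c} {g} (τ-KInvariant c) (G₀-KInvariant g∈G₀)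

opaque
  Φ-preserves-𝓕 : Preserves𝓕 Φ
  Φ-preserves-𝓕 = toWitness {a? = Preserves𝓕? Φ} _

  Φinv-preserves-𝓕 : Preserves𝓕 Φinv
  Φinv-preserves-𝓕 = toWitness {a? = Preserves𝓕? Φinv} _

  τ-preserves-𝓕 : ∀ c → tr c ≡ 0F → Preserves𝓕 (τ c)
  τ-preserves-𝓕 = toWitness {a? = ∀-F8? λ c → (tr c ≟F 0F) →-dec Preserves𝓕? (τ c)} _

Preserves𝓕-∘ : ∀ {h g} → h Preserves _~_ ⟶ _~_ → Preserves𝓕 h → Preserves𝓕 g → Preserves𝓕 (h ∘ g)
Preserves𝓕-∘ h-resp h-pres g-pres i =
  let (j , gi~j) = g-pres i
      (k , hj~k) = h-pres j
  in k , ~-trans (h-resp gi~j) hj~k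

G₀-preserves-𝓕 : ∀ {g} → InG0 g → Preserves𝓕 g
G₀-preserves-𝓕 g-id i = i , ~-refl (𝓕 i)
G₀-preserves-𝓕 (g-Φ {g} g∈G₀) =
  Preserves𝓕-∘ {Φ} {g} Φ-preserves-~ Φ-preserves-𝓕 (G₀-preserves-𝓕 g∈G₀)
G₀-preserves-𝓕 (g-Φinv {g} g∈G₀) =
  Preserves𝓕-∘ {Φinv} {g} Φinv-preserves-~ Φinv-preserves-𝓕 (G₀-preserves-𝓕 g∈G₀)
G₀-preserves-𝓕 (g-τ {g} c tr≡0 g∈G₀) =
  Preserves𝓕-∘ {τ c} {g} (τ-preserves-~ c) (τ-preserves-𝓕 c tr≡0) (G₀-preserves-𝓕 g∈G₀)

JoinsExternal : (Fin 5 → V) → Set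
JoinsExternal F = ∀ i j → ¬ i ≡ j → ∀ L → NonZeroV L → OnLine L (F i) → OnLine L (F j) →
  ExternalLine L

JoinsExternal? : Decidable JoinsExternal
JoinsExternal? F = Fin.all? λ i → Fin.all? λ j → ¬? (i Fin.≟ j) →-dec
  ∀-V? λ L → NonZeroV? L →-dec (OnLine? L (F i) →-dec (OnLine? L (F j) →-dec ExternalLine? L))

opaque
  externalPentagon : ExternalPentagon 𝓕
  externalPentagon = toWitness {a? = GeneralPosition? 𝓕} _ , toWitness {a? = JoinsExternal? 𝓕} _

lemma3p4 : ExternalPentagon 𝓕 ×
           (∃ λ f → IsoA4G0 f) ×
           (∀ g → InG0 g → PreservesK g × Preserves𝓕 g)
lemma3p4 = externalPentagon , (toG₀ , toG₀-isomorphism) ,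
  λ g g∈G₀ → (λ v _ → G₀-KInvariant g∈G₀ v) , G₀-preserves-𝓕 g∈G₀
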